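{- Let $p=(12,\{(0,0),(1,0),(2,0),(2,1)\})$ and $p'=(21,\{(0,1),(1,1),(2,1),(2,2)\})$. Then $p$ and $p'$ are equidistributed. Moreover, for all $n\ge 1$ and $k\ge 0$, the number $\widetilde{T}_{n,k}$ of permutations in $S_n$ with exactly $k$ occurrences of $p$ equals $c(n,k+1)$.
   Context: $S_n$ is the set of permutations of $\{1,\dots,n\}$. A mesh pattern of length $k$ is a pair $(\tau,R)$ with $\tau\in S_k$ and $R\subseteq\{0,\dots,k\}^2$; the element $(a,b)\in R$ is the "shaded box" whose corners are $(a,b),(a,b+1),(a+1,b+1),(a+1,b)$ in the plot of $\tau$ (first coordinate = position, second = value). An occurrence of $(\tau,R)$ in $\pi=\pi_1\cdots\pi_n\in S_n$ is a tuple of indices $i_1<\dots<i_k$ such that $\pi_{i_1}\cdots\pi_{i_k}$ is order-isomorphic to $\tau$ and, setting $i_0=0$, $i_{k+1}=n+1$, letting $v_1<\dots<v_k$ be the values $\pi_{i_1},\dots,\pi_{i_k}$ in increasing order and $v_0=0$, $v_{k+1}=n+1$, for every $(a,b)\in R$ there is no index $m$ with $i_a<m<i_{a+1}$ and $v_b<\pi_m<v_{b+1}$. The number of occurrences is the number of such index tuples. Two patterns are equidistributed if for all $n,k$ the number of $\pi\in S_n$ with exactly $k$ occurrences of the first equals the number with exactly $k$ occurrences of the second. $c(n,k)$ denotes the unsigned Stirling numbers of the first kind: $c(0,0)=1$, $c(n,k)=0$ if $n<k$ or if $k=0<n$, and $c(n,k)=(n-1)c(n-1,k)+c(n-1,k-1)$.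 -}

module Defs where

open import Data.Nat using (ℕ; zero; suc; _+_; _*_; _∸_; _<ᵇ_; _≡ᵇ_)
open import Data.Bool using (Bool; true; false; _∧_; _∨_; not; if_then_else_)
open import Data.List using (List; []; _∷_; _++_; map; length; filterᵇ; concatMap; upTo; applyUpTo)
open import Data.Bool.ListAction using (all; any)
open import Data.Product using (_×_; _,_)
open import Relation.Nullary.Decidable using (does)
open import Data.Nat.Properties using (_≟_)
open import Relation.Binary.PropositionalEquality using (_≡_)

c : ℕ → ℕ → ℕ
c zero    zero    = 1
c zero    (suc k) = 0
c (suc n) zero    = 0
c (suc n) (suc k) = n * c n (suc k) + c n k

-- 0-indexed lookup with default 0.
nth : List ℕ → ℕ → ℕ
nth []       _       = 0
nth (x ∷ xs) zero    = x
nth (x ∷ xs) (suc i) = nth xs i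

range1 : ℕ → List ℕ
range1 n = applyUpTo suc n

words : ℕ → ℕ → List (List ℕ)
words zero    m = [] ∷ []
words (suc n) m = concatMap (λ x → map (x ∷_) (words n m)) (range1 m)

distinct : List ℕ → Bool
distinct []       = true
distinct (x ∷ xs) = not (any (λ y → x ≡ᵇ y) xs) ∧ distinct xs

-- S_n: the permutations of {1,…,n} in one-line notation π₁⋯πₙ
S : ℕ → List (List ℕ)
S n = filterᵇ distinct (words n n)

choose : ℕ → List ℕ → List (List ℕ)
choose zero    _        = [] ∷ []
choose (suc k) []       = []
choose (suc k) (x ∷ xs) = map (x ∷_) (choose k xs) ++ choose (suc k) xs

insert : ℕ → List ℕ → List ℕ
insert x []       = x ∷ []
insert x (y ∷ ys) = if x Data.Nat.≤ᵇ y then x ∷ y ∷ ys else y ∷ insert x ys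

sort : List ℕ → List ℕ
sort []       = []
sort (x ∷ xs) = insert x (sort xs)

-- A mesh pattern (τ, R): τ ∈ S_k in one-line notation (values 1..k),
-- R a list of shaded boxes (a,b) with 0 ≤ a,b ≤ k.
record MeshPattern : Set where
  constructor mesh
  field
    len    : ℕ
    τ      : List ℕ
    shaded : List (ℕ × ℕ)
open MeshPattern public

orderIso : ℕ → List ℕ → List ℕ → Bool
orderIso k xs ys =
  all (λ a → all (λ b → (nth xs a <ᵇ nth xs b) ≡ᵇool (nth ys a <ᵇ nth ys b))
                 (upTo k)) (upTo k)
  where
  _≡ᵇool_ : Bool → Bool → Bool
  true  ≡ᵇool y = y
  false ≡ᵇool y = not y

-- Is the index tuple is = (i₁<⋯<i_k) (1-based positions) an occurrence of p in π ∈ S_n?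
isOccurrence : MeshPattern → ℕ → List ℕ → List ℕ → Bool
isOccurrence p n π is =
  orderIso (len p) (map (λ i → nth π (i ∸ 1)) is) (τ p)
  ∧ all boxEmpty (shaded p)
  where
  I : List ℕ
  I = 0 ∷ is ++ (suc n ∷ [])
  V : List ℕ
  V = 0 ∷ sort (map (λ i → nth π (i ∸ 1)) is) ++ (suc n ∷ [])
  boxEmpty : ℕ × ℕ → Bool
  boxEmpty (a , b) =
    not (any (λ m → (nth I a <ᵇ m) ∧ (m <ᵇ nth I (suc a))
                    ∧ (nth V b <ᵇ nth π (m ∸ 1)) ∧ (nth π (m ∸ 1) <ᵇ nth V (suc b)))
             (range1 n))

occ : MeshPattern → ℕ → List ℕ → ℕ
occ p n π = length (filterᵇ (isOccurrence p n π)
                           (choose (len p) (range1 n)))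

count : MeshPattern → ℕ → ℕ → ℕ
count p n k = length (filterᵇ (λ π → occ p n π ≡ᵇ k) (S n))

Equidistributed : MeshPattern → MeshPattern → Set
Equidistributed p q = ∀ n k → count p n k ≡ count q n k

p : MeshPattern
p = mesh 2 (1 ∷ 2 ∷ []) ((0 , 0) ∷ (1 , 0) ∷ (2 , 0) ∷ (2 , 1) ∷ [])

p' : MeshPattern
p' = mesh 2 (2 ∷ 1 ∷ []) ((0 , 1) ∷ (1 , 1) ∷ (2 , 1) ∷ (2 , 2) ∷ [])

-- An occurrence of p is a pair a before b with a < b in which a is the least entry and no entry
-- after b lies between a and b.  So b ranges over the right-to-left minima other than the least
-- entry, and occ p = (number of right-to-left minima) - 1.  Dually, an occurrence of p' is an
-- entry b preceded by its successor b + 1 with no entry after b exceeding b + 1, so b ranges over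
-- the right-to-left maxima other than n, and occ p' = (number of right-to-left maxima) - 1.  Both
-- record statistics have distribution c(n, k): the first entry of an arrangement of a set is a
-- record exactly when it is the extreme element, which gives c(n+1, k+1) = c(n, k) + n c(n, k+1).

module Submission where

open import Defs

open import Level using (0ℓ)
open import Function using (_∘_; _⇔_; mk⇔; Equivalence; case_of_)
open import Data.Empty using (⊥-elim)
open import Data.Sum using (inj₁; inj₂)
open import Data.Product using (_×_; _,_; proj₁; proj₂; ∃-syntax; map₁)
open import Data.Bool using (Bool; true; false; _∧_; _∨_; not; if_then_else_; T; T?)
open import Data.Bool.Properties
  using (T-≡; T-not-≡; T-∧; ∧-assoc; ∧-zeroʳ; ∧-identityʳ; ∨-zeroʳ; ∨-identityʳ)
open import Data.Bool.ListAction using (any; or)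
open import Data.Nat
  using (ℕ; zero; suc; _+_; _*_; _∸_; _<ᵇ_; _≤ᵇ_; _≡ᵇ_; _<_; _≤_; z≤n; s≤s; _<?_; _>?_; _≟_)
open import Data.Nat.Properties
  using ( +-suc; +-assoc; +-comm; +-identityʳ; +-commutativeSemigroup; suc-injective
        ; <ᵇ⇒<; <⇒<ᵇ; ≤ᵇ⇒≤; ≤⇒≤ᵇ; ≡ᵇ⇒≡; ≡⇒≡ᵇ
        ; ≤-refl; ≤-reflexive; <-irrefl; <-trans; <-≤-trans; ≤-<-trans
        ; <⇒≤; <⇒≢; <⇒≱; ≮⇒≥; ≤∧≢⇒<
        ; <-cmp; <-isStrictTotalOrder )
open import Data.Nat.ListAction using (sum)
open import Algebra.Properties.CommutativeSemigroup +-commutativeSemigroup using (x∙yz≈y∙xz)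
open import Data.List using (List; []; _∷_; _++_; map; length; filterᵇ; concatMap; upTo; applyUpTo; drop; take)
open import Data.List.Properties
  using ( length-++; filter-++; filter-notAll; filter-all; length-applyUpTo
        ; map-∘; map-++; map-cong; map-cong-local; map-upTo; map-applyUpTo )
open import Data.List.Relation.Unary.All as All using (All; []; _∷_)
open import Data.List.Relation.Unary.All.Properties using (drop⁺)
open import Data.List.Relation.Unary.Any using (here; there)
open import Data.List.Relation.Unary.Any.Properties using (any⁺; any⁻; concatMap⁻)
open import Data.List.Relation.Unary.Unique.Propositional using (Unique; []; _∷_)
open import Data.List.Relation.Unary.Unique.Propositional.Properties using (filter⁺; applyUpTo⁺₁)
open import Data.List.Membership.Propositional using (_∈_; lose; find)
open import Data.List.Membership.Propositional.Properties
  using (∈-++⁺ˡ; ∈-++⁺ʳ; ∈-++⁻; ∈-map⁻; ∈-filter⁺; ∈-filter⁻; ∈-upTo⁻; ∈-applyUpTo⁻)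
open import Data.List.Membership.DecPropositional _≟_ using (_∈?_)
open import Relation.Nullary using (¬_; contradiction)
open import Relation.Nullary.Decidable using (does; yes; no; fromWitness; toWitness; isYes≗does)
open import Relation.Binary using (Rel; Decidable; IsStrictTotalOrder; tri<; tri≈; tri>)
import Relation.Binary.Construct.Flip.EqAndOrd as Flip
open import Relation.Binary.PropositionalEquality
  using (_≡_; _≢_; refl; sym; trans; cong; cong₂; subst; module ≡-Reasoning)

open ≡-Reasoning

private
  variable
    A B : Set

T-injective : ∀ {x y} → (T x ⇔ T y) → x ≡ y
T-injective {false} {false} _ = refl
T-injective {false} {true}  x⇔y = ⊥-elim (Equivalence.from x⇔y _)
T-injective {true}  {false} x⇔y = ⊥-elim (Equivalence.to x⇔y _)
T-injective {true}  {true}  _ = refl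

T-not⇒¬T : ∀ {b} → T (not b) → ¬ T b
T-not⇒¬T {false} _ ()

¬T⇒T-not : ∀ {b} → ¬ T b → T (not b)
¬T⇒T-not {false} _   = _
¬T⇒T-not {true}  ¬tt = ¬tt _

<ᵇ-true : ∀ {m n} → m < n → (m <ᵇ n) ≡ true
<ᵇ-true m<n = Equivalence.to T-≡ (<⇒<ᵇ m<n)

<ᵇ-false : ∀ {m n} → n ≤ m → (m <ᵇ n) ≡ false
<ᵇ-false {m} {n} n≤m = Equivalence.to T-not-≡ (¬T⇒T-not (λ m<ᵇn → <⇒≱ (<ᵇ⇒< m n m<ᵇn) n≤m))

≤ᵇ-true : ∀ {m n} → m ≤ n → (m ≤ᵇ n) ≡ true
≤ᵇ-true m≤n = Equivalence.to T-≡ (≤⇒≤ᵇ m≤n)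

≤ᵇ-false : ∀ {m n} → n < m → (m ≤ᵇ n) ≡ false
≤ᵇ-false {m} {n} n<m = Equivalence.to T-not-≡ (¬T⇒T-not (λ m≤ᵇn → <⇒≱ n<m (≤ᵇ⇒≤ m n m≤ᵇn)))

any-map : (P : B → Bool) (f : A → B) (xs : List A) → any P (map f xs) ≡ any (P ∘ f) xs
any-map P f xs = cong or (sym (map-∘ xs))

any-∨ : (P Q : A → Bool) (xs : List A) → (any P xs ∨ any Q xs) ≡ any (λ x → P x ∨ Q x) xs
any-∨ P Q []       = refl
any-∨ P Q (x ∷ xs) with P x | Q x
... | true  | _     = refl
... | false | true  = ∨-zeroʳ (any P xs)
... | false | false = any-∨ P Q xs

any-upTo-suc : (P : ℕ → Bool) (n : ℕ) → any P (upTo (suc n)) ≡ (P 0 ∨ any (P ∘ suc) (upTo n))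
any-upTo-suc P n = cong (P 0 ∨_) (trans (cong (any P) (sym (map-upTo suc n))) (any-map P suc (upTo n)))

countᵇ : (A → Bool) → List A → ℕ
countᵇ P xs = length (filterᵇ P xs)

countᵇ-∷ : (P : A → Bool) (x : A) (xs : List A) →
           countᵇ P (x ∷ xs) ≡ (if P x then suc (countᵇ P xs) else countᵇ P xs)
countᵇ-∷ P x xs with P x
... | true  = refl
... | false = refl

countᵇ-++ : (P : A → Bool) (xs ys : List A) → countᵇ P (xs ++ ys) ≡ countᵇ P xs + countᵇ P ys
countᵇ-++ P xs ys = trans (cong length (filter-++ _ xs ys)) (length-++ (filterᵇ P xs))

countᵇ-map : (P : B → Bool) (f : A → B) (xs : List A) → countᵇ P (map f xs) ≡ countᵇ (P ∘ f) xs
countᵇ-map P f []       = refl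
countᵇ-map P f (x ∷ xs) with P (f x)
... | true  = cong suc (countᵇ-map P f xs)
... | false = countᵇ-map P f xs

countᵇ-concatMap : (P : B → Bool) (f : A → List B) (xs : List A) →
                   countᵇ P (concatMap f xs) ≡ sum (map (countᵇ P ∘ f) xs)
countᵇ-concatMap P f []       = refl
countᵇ-concatMap P f (x ∷ xs) =
  trans (countᵇ-++ P (f x) (concatMap f xs)) (cong (countᵇ P (f x) +_) (countᵇ-concatMap P f xs))

countᵇ-filterᵇ : (P Q : A → Bool) (xs : List A) → countᵇ P (filterᵇ Q xs) ≡ countᵇ (λ x → Q x ∧ P x) xs
countᵇ-filterᵇ P Q []       = refl
countᵇ-filterᵇ P Q (x ∷ xs) rewrite countᵇ-∷ (λ y → Q y ∧ P y) x xs with Q x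
... | false = countᵇ-filterᵇ P Q xs
... | true  rewrite countᵇ-∷ P x (filterᵇ Q xs) with P x
...   | true  = cong suc (countᵇ-filterᵇ P Q xs)
...   | false = countᵇ-filterᵇ P Q xs

countᵇ-cong : {P Q : A → Bool} (xs : List A) → (∀ {x} → x ∈ xs → P x ≡ Q x) →
              countᵇ P xs ≡ countᵇ Q xs
countᵇ-cong []       _   = refl
countᵇ-cong {P = P} {Q} (x ∷ xs) P≡Q with P x | Q x | P≡Q (here refl) | countᵇ-cong xs (P≡Q ∘ there)
... | true  | .true  | refl | ih = cong suc ih
... | false | .false | refl | ih = ih

countᵇ-cong-∧ : {P Q R : A → Bool} (xs : List A) → (∀ {x} → x ∈ xs → T (P x) → Q x ≡ R x) →
                countᵇ (λ x → P x ∧ Q x) xs ≡ countᵇ (λ x → P x ∧ R x) xs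
countᵇ-cong-∧ {P = P} xs Q≡R = countᵇ-cong xs (λ {x} x∈xs → guarded (P x) (Q≡R x∈xs))
  where
  guarded : ∀ p {q r} → (T p → q ≡ r) → (p ∧ q) ≡ (p ∧ r)
  guarded false _   = refl
  guarded true  q≡r = q≡r _

countᵇ-none : {P : A → Bool} (xs : List A) → (∀ {x} → x ∈ xs → ¬ T (P x)) → countᵇ P xs ≡ 0
countᵇ-none []       _  = refl
countᵇ-none {P = P} (x ∷ xs) ¬P with P x in Px
... | true  = ⊥-elim (¬P (here refl) (Equivalence.from T-≡ Px))
... | false = countᵇ-none xs (¬P ∘ there)

countᵇ-split : (P Q : A → Bool) (xs : List A) →
               countᵇ P xs ≡ countᵇ (λ x → P x ∧ Q x) xs + countᵇ (λ x → P x ∧ not (Q x)) xs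
countᵇ-split P Q []       = refl
countᵇ-split P Q (x ∷ xs) with P x | Q x
... | true  | true  = cong suc (countᵇ-split P Q xs)
... | true  | false = trans (cong suc (countᵇ-split P Q xs)) (sym (+-suc _ _))
... | false | _     = countᵇ-split P Q xs

countᵇ-complement : (P : A → Bool) (xs : List A) → countᵇ P xs + countᵇ (not ∘ P) xs ≡ length xs
countᵇ-complement P []       = refl
countᵇ-complement P (x ∷ xs) with P x
... | true  = cong suc (countᵇ-complement P xs)
... | false = trans (+-suc _ _) (cong suc (countᵇ-complement P xs))

countᵇ-atMostOne : {P : A → Bool} {xs : List A} → Unique xs →
                   (∀ {a a'} → a ∈ xs → a' ∈ xs → T (P a) → T (P a') → a ≡ a') →
                   countᵇ P xs ≡ (if any P xs then 1 else 0)
countᵇ-atMostOne {xs = []}     _            _   = refl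
countᵇ-atMostOne {P = P} {x ∷ xs} (x∉xs ∷ !xs) one with P x in Px
... | true  = cong suc (countᵇ-none xs λ a∈xs Pa →
                All.lookup x∉xs a∈xs (one (here refl) (there a∈xs) (Equivalence.from T-≡ Px) Pa))
... | false = countᵇ-atMostOne !xs λ a∈ a'∈ → one (there a∈) (there a'∈)

countᵇ-exactlyOne : {P : A → Bool} {xs : List A} {x : A} → Unique xs → x ∈ xs → T (P x) →
                    (∀ {a a'} → a ∈ xs → a' ∈ xs → T (P a) → T (P a') → a ≡ a') →
                    countᵇ P xs ≡ 1
countᵇ-exactlyOne {P = P} !xs x∈xs Px one =
  trans (countᵇ-atMostOne !xs one)
        (cong (λ c → if c then 1 else 0) (Equivalence.to T-≡ (any⁺ P (lose x∈xs Px))))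

sum-indicator : (f : A → ℕ) (c : A → Bool) (xs : List A) →
                (∀ {x} → x ∈ xs → f x ≡ (if c x then 1 else 0)) → sum (map f xs) ≡ countᵇ c xs
sum-indicator f c []       _  = refl
sum-indicator f c (x ∷ xs) f≡ with c x | f≡ (here refl)
... | true  | fx≡1 = cong₂ _+_ fx≡1 (sum-indicator f c xs (f≡ ∘ there))
... | false | fx≡0 = cong₂ _+_ fx≡0 (sum-indicator f c xs (f≡ ∘ there))

sum-if : (P : A → Bool) (m n : ℕ) (xs : List A) →
         sum (map (λ x → if P x then m else n) xs) ≡ countᵇ P xs * m + countᵇ (not ∘ P) xs * n
sum-if P m n []       = refl
sum-if P m n (x ∷ xs) with P x
... | true  = trans (cong (m +_) (sum-if P m n xs)) (sym (+-assoc m _ _))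
... | false = trans (cong (n +_) (sum-if P m n xs))
                    (x∙yz≈y∙xz n (countᵇ P xs * m) (countᵇ (not ∘ P) xs * n))

sum-map-filterᵇ : (F : A → ℕ) (Q : A → Bool) (xs : List A) →
                  sum (map F (filterᵇ Q xs)) ≡ sum (map (λ x → if Q x then F x else 0) xs)
sum-map-filterᵇ F Q []       = refl
sum-map-filterᵇ F Q (x ∷ xs) with Q x
... | true  = cong (F x +_) (sum-map-filterᵇ F Q xs)
... | false = sum-map-filterᵇ F Q xs

Unique-++⁻ : (xs : List A) {ys : List A} → Unique (xs ++ ys) →
             Unique xs × (∀ {x y} → x ∈ xs → y ∈ ys → x ≢ y)
Unique-++⁻ []       !ys           = [] , λ ()
Unique-++⁻ (x ∷ xs) (x∉ ∷ !xs++ys) with Unique-++⁻ xs !xs++ys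
... | !xs , disjoint =
  All.tabulate (λ x'∈xs → All.lookup x∉ (∈-++⁺ˡ x'∈xs)) ∷ !xs ,
  λ { (here refl) y∈ys → All.lookup x∉ (∈-++⁺ʳ xs y∈ys) ; (there x∈xs) → disjoint x∈xs }

∈-prefix : ∀ {pre : List A} {b rest m} → m ∈ pre ++ b ∷ rest → m ≢ b → ¬ m ∈ rest → m ∈ pre
∈-prefix {pre = pre} m∈ m≢b m∉rest with ∈-++⁻ pre m∈
... | inj₁ m∈pre          = m∈pre
... | inj₂ (here m≡b)     = ⊥-elim (m≢b m≡b)
... | inj₂ (there m∈rest) = ⊥-elim (m∉rest m∈rest)

distinct⇒Unique : (xs : List ℕ) → T (distinct xs) → Unique xs
distinct⇒Unique []       _ = []
distinct⇒Unique (x ∷ xs) d with Equivalence.to T-∧ d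
... | x∉xs , dxs =
  All.tabulate (λ {y} y∈xs x≡y → T-not⇒¬T x∉xs (any⁺ _ (lose y∈xs (≡⇒≡ᵇ x y x≡y))))
  ∷ distinct⇒Unique xs dxs

remove : ℕ → List ℕ → List ℕ
remove x = filterᵇ (λ y → not (x ≡ᵇ y))

∈-remove⁺ : ∀ {x y ys} → y ∈ ys → y ≢ x → y ∈ remove x ys
∈-remove⁺ {x} {y} y∈ys y≢x =
  ∈-filter⁺ (T? ∘ λ y → not (x ≡ᵇ y)) y∈ys (¬T⇒T-not (λ x≡ᵇy → y≢x (sym (≡ᵇ⇒≡ x y x≡ᵇy))))

∈-remove⁻ : ∀ {x y ys} → y ∈ remove x ys → y ∈ ys
∈-remove⁻ {x} y∈ = proj₁ (∈-filter⁻ (T? ∘ λ y → not (x ≡ᵇ y)) y∈)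

length-remove< : ∀ {x ys} → x ∈ ys → length (remove x ys) < length ys
length-remove< {x} x∈ys =
  filter-notAll (T? ∘ λ y → not (x ≡ᵇ y)) _ (lose x∈ys (λ t → T-not⇒¬T t (≡⇒≡ᵇ x x refl)))

length-remove : ∀ {x ys} → Unique ys → x ∈ ys → suc (length (remove x ys)) ≡ length ys
length-remove {x} {y ∷ ys} (y∉ys ∷ _) (here refl) rewrite Equivalence.to T-≡ (≡⇒≡ᵇ x x refl) =
  cong (suc ∘ length) (filter-all (T? ∘ λ z → not (x ≡ᵇ z)) (All.map (λ x≢z → ¬T⇒T-not (x≢z ∘ ≡ᵇ⇒≡ x _)) y∉ys))
length-remove {x} {y ∷ ys} (y∉ys ∷ !ys) (there x∈ys) with x ≡ᵇ y in x≡ᵇy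
... | true  = ⊥-elim (All.lookup y∉ys x∈ys (sym (≡ᵇ⇒≡ x y (Equivalence.from T-≡ x≡ᵇy))))
... | false = cong suc (length-remove !ys x∈ys)

Unique⇒length≤ : ∀ {xs ys} → Unique xs → All (_∈ ys) xs → length xs ≤ length ys
Unique⇒length≤ []                 _                = z≤n
Unique⇒length≤ {x ∷ xs} {ys} (x∉xs ∷ !xs) (x∈ys ∷ xs⊆ys) =
  <-≤-trans (s≤s (Unique⇒length≤ !xs xs⊆ys∖x)) (length-remove< x∈ys)
  where
  xs⊆ys∖x = All.zipWith (λ (x≢z , z∈ys) → ∈-remove⁺ z∈ys (x≢z ∘ sym)) (x∉xs , xs⊆ys)

pigeonhole : ∀ {xs ys z} → Unique xs → All (_∈ ys) xs → length ys ≤ length xs → z ∈ ys → z ∈ xs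
pigeonhole {xs} {ys} {z} !xs xs⊆ys |ys|≤|xs| z∈ys with z ∈? xs
... | yes z∈xs = z∈xs
... | no  z∉xs =
  contradiction |ys|≤|xs| (<⇒≱ (≤-<-trans (Unique⇒length≤ !xs xs⊆ys∖z) (length-remove< z∈ys)))
  where
  xs⊆ys∖z = All.tabulate λ {w} w∈xs → ∈-remove⁺ {z} (All.lookup xs⊆ys w∈xs) λ { refl → z∉xs w∈xs }

splits : List A → List (List A × A × List A)
splits []       = []
splits (x ∷ xs) = ([] , x , xs) ∷ map (map₁ (x ∷_)) (splits xs)

splits-pivots : (xs : List A) → map (proj₁ ∘ proj₂) (splits xs) ≡ xs
splits-pivots []       = refl
splits-pivots (x ∷ xs) = cong (x ∷_) (trans (sym (map-∘ (splits xs))) (splits-pivots xs))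

∈-splits⁻ : (xs : List A) {pre : List A} {b : A} {rest : List A} →
            (pre , b , rest) ∈ splits xs → pre ++ b ∷ rest ≡ xs
∈-splits⁻ (x ∷ xs) (here refl) = refl
∈-splits⁻ (x ∷ xs) (there t∈)  with ∈-map⁻ (map₁ (x ∷_)) t∈
... | (pre , b , rest) , t∈′ , refl = cong (x ∷_) (∈-splits⁻ xs t∈′)

splits-upTo : (xs : List ℕ) →
              map (λ j → take j xs , nth xs j , drop (suc j) xs) (upTo (length xs)) ≡ splits xs
splits-upTo []       = refl
splits-upTo (x ∷ xs) = cong (([] , x , xs) ∷_) (begin
  map splitAt (applyUpTo suc (length xs))         ≡⟨ map-applyUpTo suc splitAt (length xs) ⟩
  applyUpTo (splitAt ∘ suc) (length xs)           ≡⟨ map-upTo (splitAt ∘ suc) (length xs) ⟨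
  map (map₁ (x ∷_) ∘ splitAt′) (upTo (length xs)) ≡⟨ map-∘ (upTo (length xs)) ⟩
  map (map₁ (x ∷_)) (map splitAt′ (upTo (length xs))) ≡⟨ cong (map (map₁ (x ∷_))) (splits-upTo xs) ⟩
  map (map₁ (x ∷_)) (splits xs)                   ∎)
  where
  splitAt splitAt′ : ℕ → List ℕ × ℕ × List ℕ
  splitAt  j = take j (x ∷ xs) , nth (x ∷ xs) j , drop (suc j) (x ∷ xs)
  splitAt′ j = take j xs , nth xs j , drop (suc j) xs

pairCount : (A → A → List A → Bool) → List A → ℕ
pairCount S xs = sum (map (λ (pre , b , rest) → countᵇ (λ a → S a b rest) pre) (splits xs))

pairCount-∷ : (S : A → A → List A → Bool) (x : A) (xs : List A) →
              pairCount S (x ∷ xs) ≡ countᵇ (λ (_ , b , rest) → S x b rest) (splits xs) + pairCount S xs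
pairCount-∷ {A} S x xs = trans (cong sum (sym (map-∘ (splits xs)))) (extend (splits xs))
  where
  countBefore countBeforeWithx countWithx : List (List A × A × List A) → ℕ
  countBefore      = sum ∘ map (λ (pre , b , rest) → countᵇ (λ a → S a b rest) pre)
  countBeforeWithx = sum ∘ map (λ (pre , b , rest) → countᵇ (λ a → S a b rest) (x ∷ pre))
  countWithx       = countᵇ (λ (_ , b , rest) → S x b rest)

  extend : ∀ ts → countBeforeWithx ts ≡ countWithx ts + countBefore ts
  reassociate : ∀ m ts → m + countBeforeWithx ts ≡ countWithx ts + (m + countBefore ts)

  extend []                      = refl
  extend ((pre , b , rest) ∷ ts) with S x b rest
  ... | true  = cong suc (reassociate (countᵇ (λ a → S a b rest) pre) ts)
  ... | false = reassociate (countᵇ (λ a → S a b rest) pre) ts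

  reassociate m ts = trans (cong (m +_) (extend ts)) (x∙yz≈y∙xz m (countWithx ts) (countBefore ts))

choose-map : (f : ℕ → ℕ) (k : ℕ) (xs : List ℕ) → choose k (map f xs) ≡ map (map f) (choose k xs)
choose-map f zero    xs       = refl
choose-map f (suc k) []       = refl
choose-map f (suc k) (x ∷ xs) = begin
  map (f x ∷_) (choose k (map f xs)) ++ choose (suc k) (map f xs)
    ≡⟨ cong₂ _++_ (cong (map (f x ∷_)) (choose-map f k xs)) (choose-map f (suc k) xs) ⟩
  map (f x ∷_) (map (map f) (choose k xs)) ++ map (map f) (choose (suc k) xs)
    ≡⟨ cong (_++ _) (trans (sym (map-∘ (choose k xs))) (map-∘ (choose k xs))) ⟩
  map (map f) (map (x ∷_) (choose k xs)) ++ map (map f) (choose (suc k) xs)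
    ≡⟨ map-++ (map f) (map (x ∷_) (choose k xs)) (choose (suc k) xs) ⟨
  map (map f) (map (x ∷_) (choose k xs) ++ choose (suc k) xs) ∎


choose-1 : (xs : List ℕ) → choose 1 xs ≡ map (_∷ []) xs
choose-1 []       = refl
choose-1 (x ∷ xs) = cong ((x ∷ []) ∷_) (choose-1 xs)

pairCount-choose2 : (Q : List ℕ → Bool) (S : ℕ → ℕ → List ℕ → Bool) (xs : List ℕ) →
  (∀ {i j} → i < j → j < length xs → Q (i ∷ j ∷ []) ≡ S (nth xs i) (nth xs j) (drop (suc j) xs)) →
  countᵇ Q (choose 2 (upTo (length xs))) ≡ pairCount S xs
pairCount-choose2 Q S []       _   = refl
pairCount-choose2 Q S (x ∷ xs) Q≡S = begin
  countᵇ Q (choose 2 (0 ∷ applyUpTo suc L))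
    ≡⟨ cong (countᵇ Q ∘ choose 2 ∘ (0 ∷_)) (map-upTo suc L) ⟨
  countᵇ Q (map (0 ∷_) (choose 1 (map suc U)) ++ choose 2 (map suc U))
    ≡⟨ countᵇ-++ Q (map (0 ∷_) (choose 1 (map suc U))) (choose 2 (map suc U)) ⟩
  countᵇ Q (map (0 ∷_) (choose 1 (map suc U))) + countᵇ Q (choose 2 (map suc U))
    ≡⟨ cong₂ _+_ pairsWithHead pairsInTail ⟩
  countᵇ (λ (_ , b , rest) → S x b rest) (splits xs) + pairCount S xs
    ≡⟨ pairCount-∷ S x xs ⟨
  pairCount S (x ∷ xs) ∎
  where
  L = length xs
  U = upTo L
  pairsWithHead : countᵇ Q (map (0 ∷_) (choose 1 (map suc U)))
                  ≡ countᵇ (λ (_ , b , rest) → S x b rest) (splits xs)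
  pairsWithHead = begin
    countᵇ Q (map (0 ∷_) (choose 1 (map suc U)))
      ≡⟨ cong (countᵇ Q ∘ map (0 ∷_)) (trans (choose-1 (map suc U)) (sym (map-∘ U))) ⟩
    countᵇ Q (map (0 ∷_) (map (λ j → suc j ∷ []) U))
      ≡⟨ countᵇ-map Q (0 ∷_) (map (λ j → suc j ∷ []) U) ⟩
    countᵇ (Q ∘ (0 ∷_)) (map (λ j → suc j ∷ []) U)
      ≡⟨ countᵇ-map (Q ∘ (0 ∷_)) (λ j → suc j ∷ []) U ⟩
    countᵇ (λ j → Q (0 ∷ suc j ∷ [])) U
      ≡⟨ countᵇ-cong U (λ j∈U → Q≡S (s≤s z≤n) (s≤s (∈-upTo⁻ j∈U))) ⟩
    countᵇ (λ j → S x (nth xs j) (drop (suc j) xs)) U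
      ≡⟨ countᵇ-map (λ (_ , b , rest) → S x b rest) (λ j → take j xs , nth xs j , drop (suc j) xs) U ⟨
    countᵇ (λ (_ , b , rest) → S x b rest) (map (λ j → take j xs , nth xs j , drop (suc j) xs) U)
      ≡⟨ cong (countᵇ _) (splits-upTo xs) ⟩
    countᵇ (λ (_ , b , rest) → S x b rest) (splits xs) ∎
  pairsInTail : countᵇ Q (choose 2 (map suc U)) ≡ pairCount S xs
  pairsInTail = begin
    countᵇ Q (choose 2 (map suc U))       ≡⟨ cong (countᵇ Q) (choose-map suc 2 U) ⟩
    countᵇ Q (map (map suc) (choose 2 U)) ≡⟨ countᵇ-map Q (map suc) (choose 2 U) ⟩
    countᵇ (Q ∘ map suc) (choose 2 U)     ≡⟨ pairCount-choose2 (Q ∘ map suc) S xs Q∘suc≡S ⟩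
    pairCount S xs                        ∎
    where
    Q∘suc≡S : ∀ {i j} → i < j → j < L → Q (suc i ∷ suc j ∷ []) ≡ S (nth xs i) (nth xs j) (drop (suc j) xs)
    Q∘suc≡S i<j j<L = Q≡S (s≤s i<j) (s≤s j<L)

occ-pairCount : ∀ {τ R} (S : ℕ → ℕ → List ℕ → Bool) (π : List ℕ) →
  (∀ {i j} → i < j → j < length π →
     isOccurrence (mesh 2 τ R) (length π) π (suc i ∷ suc j ∷ []) ≡ S (nth π i) (nth π j) (drop (suc j) π)) →
  occ (mesh 2 τ R) (length π) π ≡ pairCount S π
occ-pairCount {τ} {R} S π isOcc≡S = begin
  countᵇ isOcc (choose 2 (applyUpTo suc (length π))) ≡⟨ cong (countᵇ isOcc ∘ choose 2) (map-upTo suc (length π)) ⟨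
  countᵇ isOcc (choose 2 (map suc U))                 ≡⟨ cong (countᵇ isOcc) (choose-map suc 2 U) ⟩
  countᵇ isOcc (map (map suc) (choose 2 U))           ≡⟨ countᵇ-map isOcc (map suc) (choose 2 U) ⟩
  countᵇ (isOcc ∘ map suc) (choose 2 U)               ≡⟨ pairCount-choose2 (isOcc ∘ map suc) S π isOcc≡S ⟩
  pairCount S π                                       ∎
  where
  isOcc = isOccurrence (mesh 2 τ R) (length π) π
  U = upTo (length π)

wordsOver : ℕ → List ℕ → List (List ℕ)
wordsOver zero    A = [] ∷ []
wordsOver (suc n) A = concatMap (λ x → map (x ∷_) (wordsOver n A)) A

words≡wordsOver : (n m : ℕ) → words n m ≡ wordsOver n (range1 m)
words≡wordsOver zero    m = refl
words≡wordsOver (suc n) m = cong (λ ws → concatMap (λ x → map (x ∷_) ws) (range1 m)) (words≡wordsOver n m)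

∈-wordsOver⁻ : ∀ n {A w} → w ∈ wordsOver n A → length w ≡ n × All (_∈ A) w
∈-wordsOver⁻ zero    (here refl) = refl , []
∈-wordsOver⁻ (suc n) {A} {w} w∈
  with x , x∈A , w∈xW ← find (concatMap⁻ (λ x → map (x ∷_) (wordsOver n A)) {P = w ≡_} {xs = A} w∈)
  with u , u∈W , refl ← ∈-map⁻ (x ∷_) w∈xW
  with |u|≡n , u⊆A ← ∈-wordsOver⁻ n u∈W = cong suc |u|≡n , x∈A ∷ u⊆A

wordsOver-avoiding : (x : ℕ) (R : List ℕ → Bool) (n : ℕ) (A : List ℕ) →
  countᵇ (λ u → not (any (x ≡ᵇ_) u) ∧ R u) (wordsOver n A) ≡ countᵇ R (wordsOver n (remove x A))
wordsOver-avoiding x R zero    A =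
  countᵇ-cong {P = λ u → not (any (x ≡ᵇ_) u) ∧ R u} {Q = R} (wordsOver zero A) λ { (here refl) → refl }
wordsOver-avoiding x R (suc n) A = begin
  countᵇ avoids (concatMap (λ y → map (y ∷_) (wordsOver n A)) A)
    ≡⟨ countᵇ-concatMap avoids (λ y → map (y ∷_) (wordsOver n A)) A ⟩
  sum (map (λ y → countᵇ avoids (map (y ∷_) (wordsOver n A))) A)
    ≡⟨ cong sum (map-cong (λ y → trans (countᵇ-map avoids (y ∷_) (wordsOver n A)) (startingWith y)) A) ⟩
  sum (map (λ y → if not (x ≡ᵇ y) then F y else 0) A)
    ≡⟨ sum-map-filterᵇ F (λ y → not (x ≡ᵇ y)) A ⟨
  sum (map F (remove x A))
    ≡⟨ countᵇ-concatMap R (λ y → map (y ∷_) (wordsOver n (remove x A))) (remove x A) ⟨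
  countᵇ R (wordsOver (suc n) (remove x A)) ∎
  where
  avoids : List ℕ → Bool
  avoids u = not (any (x ≡ᵇ_) u) ∧ R u
  F : ℕ → ℕ
  F y = countᵇ R (map (y ∷_) (wordsOver n (remove x A)))
  startingWith : ∀ y → countᵇ (λ u → not ((x ≡ᵇ y) ∨ any (x ≡ᵇ_) u) ∧ R (y ∷ u)) (wordsOver n A)
                       ≡ (if not (x ≡ᵇ y) then F y else 0)
  startingWith y with x ≡ᵇ y
  ... | true  = countᵇ-none (wordsOver n A) (λ _ ())
  ... | false = trans (wordsOver-avoiding x (R ∘ (y ∷_)) n A)
                      (sym (countᵇ-map R (y ∷_) (wordsOver n (remove x A))))

countᵇ-distinctWords-suc : (Q : List ℕ → Bool) (n : ℕ) (A : List ℕ) →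
  countᵇ (λ w → distinct w ∧ Q w) (wordsOver (suc n) A)
  ≡ sum (map (λ x → countᵇ (λ u → distinct u ∧ Q (x ∷ u)) (wordsOver n (remove x A))) A)
countᵇ-distinctWords-suc Q n A =
  trans (countᵇ-concatMap _ (λ x → map (x ∷_) (wordsOver n A)) A) (cong sum (map-cong startingWith A))
  where
  startingWith : ∀ x → countᵇ (λ w → distinct w ∧ Q w) (map (x ∷_) (wordsOver n A))
                       ≡ countᵇ (λ u → distinct u ∧ Q (x ∷ u)) (wordsOver n (remove x A))
  startingWith x = begin
    countᵇ (λ w → distinct w ∧ Q w) (map (x ∷_) (wordsOver n A))
      ≡⟨ countᵇ-map (λ w → distinct w ∧ Q w) (x ∷_) (wordsOver n A) ⟩
    countᵇ (λ u → (not (any (x ≡ᵇ_) u) ∧ distinct u) ∧ Q (x ∷ u)) (wordsOver n A)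
      ≡⟨ countᵇ-cong (wordsOver n A) (λ {u} _ → ∧-assoc (not (any (x ≡ᵇ_) u)) (distinct u) (Q (x ∷ u))) ⟩
    countᵇ (λ u → not (any (x ≡ᵇ_) u) ∧ (distinct u ∧ Q (x ∷ u))) (wordsOver n A)
      ≡⟨ wordsOver-avoiding x (λ u → distinct u ∧ Q (x ∷ u)) n A ⟩
    countᵇ (λ u → distinct u ∧ Q (x ∷ u)) (wordsOver n (remove x A)) ∎

-- Right-to-left records

module Records {_≺_ : Rel ℕ 0ℓ} (≺-isStrictTotalOrder : IsStrictTotalOrder _≡_ _≺_) (_≺?_ : Decidable _≺_)
  where
  open IsStrictTotalOrder ≺-isStrictTotalOrder
    using (compare) renaming (irrefl to ≺-irrefl; trans to ≺-trans)

  someBelow : ℕ → List ℕ → Bool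
  someBelow b xs = any (λ z → does (z ≺? b)) xs

  someBelow⁺ : ∀ {b z xs} → z ∈ xs → z ≺ b → T (someBelow b xs)
  someBelow⁺ {b} {z} z∈xs z≺b = any⁺ _ (lose z∈xs (subst T (isYes≗does (z ≺? b)) (fromWitness z≺b)))

  someBelow⁻ : ∀ {b} xs → T (someBelow b xs) → ∃[ z ] z ∈ xs × z ≺ b
  someBelow⁻ {b} xs t with z , z∈xs , z≺b ← find (any⁻ _ xs t) =
    z , z∈xs , toWitness (subst T (sym (isYes≗does (z ≺? b))) z≺b)

  -- right-to-left minima for _<_, right-to-left maxima for _>_
  records : List ℕ → ℕ
  records xs = countᵇ (λ (_ , b , rest) → not (someBelow b rest)) (splits xs)

  records-∷ : (x : ℕ) (xs : List ℕ) → records (x ∷ xs) ≡ (if someBelow x xs then records xs else suc (records xs))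
  records-∷ x xs with someBelow x xs
  ... | true  = countᵇ-map _ (map₁ (x ∷_)) (splits xs)
  ... | false = cong suc (countᵇ-map _ (map₁ (x ∷_)) (splits xs))

  least-exists : ∀ {x xs} → x ∈ xs → ∃[ m ] m ∈ xs × ¬ T (someBelow m xs)
  least-exists {xs = y ∷ []}      _ = y , here refl , λ t → case someBelow⁻ (y ∷ []) t of λ where
    (_ , here refl , y≺y) → ≺-irrefl refl y≺y
  least-exists {xs = y ∷ y′ ∷ ys} _ with least-exists {xs = y′ ∷ ys} (here refl)
  ... | m , m∈ , m-least with y ≺? m
  ...   | yes y≺m = y , here refl , λ t → case someBelow⁻ (y ∷ y′ ∷ ys) t of λ where
          (_ , here refl , y≺y)  → ≺-irrefl refl y≺y
          (z , there z∈ , z≺y) → m-least (someBelow⁺ z∈ (≺-trans z≺y y≺m))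
  ...   | no y⊀m  = m , there m∈ , λ t → case someBelow⁻ (y ∷ y′ ∷ ys) t of λ where
          (_ , here refl , y≺m)  → y⊀m y≺m
          (z , there z∈ , z≺m) → m-least (someBelow⁺ z∈ z≺m)

  least-unique : ∀ {a b xs} → a ∈ xs → b ∈ xs → ¬ T (someBelow a xs) → ¬ T (someBelow b xs) → a ≡ b
  least-unique a∈ b∈ a-least b-least with compare _ _
  ... | tri< a≺b _ _ = ⊥-elim (b-least (someBelow⁺ a∈ a≺b))
  ... | tri≈ _ a≡b _ = a≡b
  ... | tri> _ _ b≺a = ⊥-elim (a-least (someBelow⁺ b∈ b≺a))

  someBelow-mono : ∀ {b xs ys} → (∀ {z} → z ∈ xs → z ∈ ys) → T (someBelow b xs) → T (someBelow b ys)
  someBelow-mono {xs = xs} xs⊆ys t with z , z∈xs , z≺b ← someBelow⁻ xs t = someBelow⁺ (xs⊆ys z∈xs) z≺b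

  countᵇ-least : ∀ {x xs} → Unique xs → x ∈ xs → countᵇ (λ b → not (someBelow b xs)) xs ≡ 1
  countᵇ-least !xs x∈xs with m , m∈xs , m-least ← least-exists x∈xs =
    countᵇ-exactlyOne !xs m∈xs (¬T⇒T-not m-least)
      (λ a∈ a'∈ a-least a'-least → least-unique a∈ a'∈ (T-not⇒¬T a-least) (T-not⇒¬T a'-least))

  records-suc : ∀ {x xs} → Unique xs → x ∈ xs →
    records xs ≡ suc (countᵇ (λ (_ , b , rest) → not (someBelow b rest) ∧ someBelow b xs) (splits xs))
  records-suc {x} {xs} !xs x∈xs = begin
    records xs
      ≡⟨ countᵇ-split _ (λ (_ , b , _) → someBelow b xs) (splits xs) ⟩
    nonLeastRecords + countᵇ (λ (_ , b , rest) → not (someBelow b rest) ∧ not (someBelow b xs)) (splits xs)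
      ≡⟨ cong (nonLeastRecords +_) leastIsRecord ⟩
    nonLeastRecords + 1
      ≡⟨ +-comm nonLeastRecords 1 ⟩
    suc nonLeastRecords ∎
    where
    nonLeastRecords = countᵇ (λ (_ , b , rest) → not (someBelow b rest) ∧ someBelow b xs) (splits xs)
    least⇒record : ∀ {pre b rest} → (pre , b , rest) ∈ splits xs →
                   (not (someBelow b rest) ∧ not (someBelow b xs)) ≡ not (someBelow b xs)
    least⇒record {pre} t∈ = T-injective (mk⇔ (proj₂ ∘ Equivalence.to T-∧) λ b-least →
      Equivalence.from T-∧ (¬T⇒T-not (T-not⇒¬T b-least ∘ someBelow-mono
        (λ z∈ → subst (_ ∈_) (∈-splits⁻ xs t∈) (∈-++⁺ʳ pre (there z∈)))) , b-least))
    leastIsRecord : countᵇ (λ (_ , b , rest) → not (someBelow b rest) ∧ not (someBelow b xs)) (splits xs) ≡ 1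
    leastIsRecord = begin
      countᵇ (λ (_ , b , rest) → not (someBelow b rest) ∧ not (someBelow b xs)) (splits xs)
        ≡⟨ countᵇ-cong (splits xs) least⇒record ⟩
      countᵇ ((λ b → not (someBelow b xs)) ∘ proj₁ ∘ proj₂) (splits xs)
        ≡⟨ countᵇ-map (λ b → not (someBelow b xs)) (proj₁ ∘ proj₂) (splits xs) ⟨
      countᵇ (λ b → not (someBelow b xs)) (map (proj₁ ∘ proj₂) (splits xs))
        ≡⟨ cong (countᵇ _) (splits-pivots xs) ⟩
      countᵇ (λ b → not (someBelow b xs)) xs
        ≡⟨ countᵇ-least !xs x∈xs ⟩
      1 ∎

  pairCount-records : (S : ℕ → ℕ → List ℕ → Bool) {x : ℕ} (xs : List ℕ) → Unique xs → x ∈ xs →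
    (∀ {pre b rest} → pre ++ b ∷ rest ≡ xs →
       countᵇ (λ a → S a b rest) pre ≡ (if not (someBelow b rest) ∧ someBelow b xs then 1 else 0)) →
    suc (pairCount S xs) ≡ records xs
  pairCount-records S xs !xs x∈xs perSplit =
    trans (cong suc (sum-indicator _ _ (splits xs) (perSplit ∘ ∈-splits⁻ xs))) (sym (records-suc !xs x∈xs))

  countᵇ-nonLeast : ∀ {A n} → Unique A → length A ≡ suc n → countᵇ (λ x → someBelow x A) A ≡ n
  countᵇ-nonLeast {A@(a ∷ _)} {n} !A |A|≡1+n = suc-injective (begin
    suc nonLeast                                                  ≡⟨ +-comm 1 nonLeast ⟩
    nonLeast + 1                                                  ≡⟨ cong (nonLeast +_) (countᵇ-least !A (here refl)) ⟨
    nonLeast + countᵇ (λ x → not (someBelow x A)) A               ≡⟨ countᵇ-complement (λ x → someBelow x A) A ⟩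
    length A                                                      ≡⟨ |A|≡1+n ⟩
    suc n                                                         ∎)
    where
    nonLeast = countᵇ (λ x → someBelow x A) A

  -- u lists every entry of A other than x, by the pigeonhole principle
  records-arrangement : ∀ {n x A u} → u ∈ wordsOver n (remove x A) → length (remove x A) ≡ n → T (distinct u) →
                        records (x ∷ u) ≡ (if someBelow x A then records u else suc (records u))
  records-arrangement {n} {x} {A} {u} u∈ |A'|≡n du with |u|≡n , u⊆A' ← ∈-wordsOver⁻ n u∈ =
    trans (records-∷ x u) (cong (λ b → if b then records u else suc (records u)) (T-injective (mk⇔
      (someBelow-mono {x} {u} {A} (λ z∈u → ∈-remove⁻ {x} {ys = A} (All.lookup u⊆A' z∈u)))
      λ t → let z , z∈A , z≺x = someBelow⁻ {x} A t in
        someBelow⁺ (pigeonhole (distinct⇒Unique u du) u⊆A' (≤-reflexive (trans |A'|≡n (sym |u|≡n)))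
                               (∈-remove⁺ {x} z∈A (λ z≡x → ≺-irrefl z≡x z≺x))) z≺x)))

  records-distribution : ∀ n {A} → Unique A → length A ≡ n → ∀ k →
    countᵇ (λ w → distinct w ∧ (records w ≡ᵇ k)) (wordsOver n A) ≡ c n k
  records-distribution zero    {[]} _ _ zero    = refl
  records-distribution zero    {[]} _ _ (suc k) = refl
  records-distribution (suc n) {A}  _ _ zero    = countᵇ-none (wordsOver (suc n) A) noRecords
    where
    noRecords : ∀ {w} → w ∈ wordsOver (suc n) A → ¬ T (distinct w ∧ (records w ≡ᵇ 0))
    noRecords {[]}    w∈ _ with () ← proj₁ (∈-wordsOver⁻ (suc n) {A} w∈)
    noRecords {x ∷ u} _  t with d , none ← Equivalence.to T-∧ t =
      subst (λ r → T (r ≡ᵇ 0)) (records-suc {x} {x ∷ u} (distinct⇒Unique (x ∷ u) d) (here refl)) none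
  records-distribution (suc n) {A@(a ∷ _)} !A |A|≡1+n (suc k) = begin
    countᵇ (λ w → distinct w ∧ (records w ≡ᵇ suc k)) (wordsOver (suc n) A)
      ≡⟨ countᵇ-distinctWords-suc (λ w → records w ≡ᵇ suc k) n A ⟩
    sum (map (λ x → countᵇ (λ u → distinct u ∧ (records (x ∷ u) ≡ᵇ suc k)) (wordsOver n (remove x A))) A)
      ≡⟨ cong sum (map-cong-local (All.tabulate startingWith)) ⟩
    sum (map (λ x → if someBelow x A then c n (suc k) else c n k) A)
      ≡⟨ sum-if (λ x → someBelow x A) (c n (suc k)) (c n k) A ⟩
    countᵇ (λ x → someBelow x A) A * c n (suc k) + countᵇ (λ x → not (someBelow x A)) A * c n k
      ≡⟨ cong₂ (λ l m → l * c n (suc k) + m * c n k) (countᵇ-nonLeast !A |A|≡1+n) (countᵇ-least !A (here refl)) ⟩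
    n * c n (suc k) + 1 * c n k
      ≡⟨ cong (n * c n (suc k) +_) (+-identityʳ (c n k)) ⟩
    c (suc n) (suc k) ∎
    where
    startingWith : ∀ {x} → x ∈ A →
      countᵇ (λ u → distinct u ∧ (records (x ∷ u) ≡ᵇ suc k)) (wordsOver n (remove x A))
      ≡ (if someBelow x A then c n (suc k) else c n k)
    startingWith {x} x∈A = trans
      (countᵇ-cong-∧ (wordsOver n (remove x A)) (λ u∈ du → cong (_≡ᵇ suc k) (records-arrangement u∈ |A'|≡n du)))
      (byHead (someBelow x A))
      where
      !A' : Unique (remove x A)
      !A' = filter⁺ (T? ∘ λ y → not (x ≡ᵇ y)) !A
      |A'|≡n : length (remove x A) ≡ n
      |A'|≡n = suc-injective (trans (length-remove !A x∈A) |A|≡1+n)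
      byHead : (b : Bool) →
        countᵇ (λ u → distinct u ∧ ((if b then records u else suc (records u)) ≡ᵇ suc k)) (wordsOver n (remove x A))
        ≡ (if b then c n (suc k) else c n k)
      byHead true  = records-distribution n !A' |A'|≡n (suc k)
      byHead false = records-distribution n !A' |A'|≡n k

module Minima = Records <-isStrictTotalOrder _<?_
module Maxima = Records (Flip.isStrictTotalOrder <-isStrictTotalOrder) _>?_

-- Shaded boxes

between : ℕ → ℕ → ℕ → Bool
between lo hi v = (lo <ᵇ v) ∧ (v <ᵇ hi)

between⁺ : ∀ {lo hi v} → lo < v → v < hi → T (between lo hi v)
between⁺ lo<v v<hi = Equivalence.from T-∧ (<⇒<ᵇ lo<v , <⇒<ᵇ v<hi)

between⁻ : ∀ lo hi v → T (between lo hi v) → lo < v × v < hi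
between⁻ lo hi v t with lo<ᵇv , v<ᵇhi ← Equivalence.to T-∧ t = <ᵇ⇒< lo v lo<ᵇv , <ᵇ⇒< v hi v<ᵇhi

-- isOccurrence's test of a shaded box: some 1-based position strictly between lo and hi holds a
-- value satisfying R
box : List ℕ → ℕ → ℕ → (ℕ → Bool) → Bool
box π lo hi R = any (λ m → (lo <ᵇ m) ∧ (m <ᵇ hi) ∧ R (nth π (m ∸ 1))) (range1 (length π))

box-last : (π : List ℕ) (lo : ℕ) (R : ℕ → Bool) → box π lo (suc (length π)) R ≡ any R (drop lo π)
box-last π lo R =
  trans (cong (any _) (sym (map-upTo suc (length π)))) (trans (any-map _ suc (upTo (length π))) (go π lo))
  where
  inLastColumn : List ℕ → ℕ → ℕ → Bool
  inLastColumn π lo m = (lo <ᵇ suc m) ∧ (suc m <ᵇ suc (length π)) ∧ R (nth π m)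
  go : (π : List ℕ) (lo : ℕ) → any (inLastColumn π lo) (upTo (length π)) ≡ any R (drop lo π)
  go []       zero     = refl
  go []       (suc lo) = refl
  go (x ∷ xs) zero     = trans (any-upTo-suc (inLastColumn (x ∷ xs) zero) (length xs)) (cong (R x ∨_) (go xs zero))
  go (x ∷ xs) (suc lo) = trans (any-upTo-suc (inLastColumn (x ∷ xs) (suc lo)) (length xs)) (go xs lo)

window-merge : ∀ {lo mid hi} m (r : Bool) → lo ≤ mid → mid ≤ hi → (m ≡ mid → ¬ T r) →
  ((lo <ᵇ m) ∧ (m <ᵇ mid) ∧ r) ∨ ((mid <ᵇ m) ∧ (m <ᵇ hi) ∧ r) ≡ (lo <ᵇ m) ∧ (m <ᵇ hi) ∧ r
window-merge {lo} {mid} {hi} m false _ _ _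
  rewrite ∧-zeroʳ (m <ᵇ mid) | ∧-zeroʳ (m <ᵇ hi) | ∧-zeroʳ (lo <ᵇ m) | ∧-zeroʳ (mid <ᵇ m) = refl
window-merge {lo} {mid} {hi} m true lo≤mid mid≤hi ¬r with <-cmp m mid
... | tri< m<mid _ _
  rewrite <ᵇ-true m<mid | <ᵇ-false {mid} {m} (<⇒≤ m<mid) | <ᵇ-true (<-≤-trans m<mid mid≤hi) = ∨-identityʳ _
... | tri≈ _ m≡mid _ = ⊥-elim (¬r m≡mid _)
... | tri> _ _ mid<m
  rewrite <ᵇ-false {m} {mid} (<⇒≤ mid<m) | <ᵇ-true mid<m | <ᵇ-true (≤-<-trans lo≤mid mid<m) = refl

box-merge : (π : List ℕ) {lo mid hi : ℕ} (R : ℕ → Bool) → lo ≤ mid → mid ≤ hi → ¬ T (R (nth π (mid ∸ 1))) →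
            (box π lo mid R ∨ box π mid hi R) ≡ box π lo hi R
box-merge π {lo} {mid} {hi} R lo≤mid mid≤hi ¬Rmid =
  trans (any-∨ (inWindow lo mid) (inWindow mid hi) (range1 (length π)))
        (cong or (map-cong merge (range1 (length π))))
  where
  inWindow : ℕ → ℕ → ℕ → Bool
  inWindow lo hi m = (lo <ᵇ m) ∧ (m <ᵇ hi) ∧ R (nth π (m ∸ 1))
  merge : ∀ m → (inWindow lo mid m ∨ inWindow mid hi m) ≡ inWindow lo hi m
  merge m = window-merge m (R (nth π (m ∸ 1))) lo≤mid mid≤hi (λ { refl → ¬Rmid })

boxes-row-corner : (π : List ℕ) {i j : ℕ} (R R′ : ℕ → Bool) → i < j → j < length π →
  ¬ T (R (nth π i)) → ¬ T (R (nth π j)) →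
  (not (box π 0 (suc i) R) ∧ (not (box π (suc i) (suc j) R) ∧ (not (box π (suc j) (suc (length π)) R)
    ∧ (not (box π (suc j) (suc (length π)) R′) ∧ true))))
  ≡ (not (any R π) ∧ not (any R′ (drop (suc j) π)))
boxes-row-corner π {i} {j} R R′ i<j j<n ¬Ri ¬Rj =
  trans (deMorgan (box π 0 (suc i) R) (box π (suc i) (suc j) R) (box π (suc j) (suc (length π)) R) _)
        (cong₂ (λ u v → not u ∧ not v) row (box-last π (suc j) R′))
  where
  deMorgan : ∀ a b c d → (not a ∧ (not b ∧ (not c ∧ (not d ∧ true)))) ≡ (not ((a ∨ b) ∨ c) ∧ not d)
  deMorgan true  _     _     _ = refl
  deMorgan false true  _     _ = refl
  deMorgan false false true  _ = refl
  deMorgan false false false d = ∧-identityʳ (not d)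
  row : ((box π 0 (suc i) R ∨ box π (suc i) (suc j) R) ∨ box π (suc j) (suc (length π)) R) ≡ any R π
  row = begin
    (box π 0 (suc i) R ∨ box π (suc i) (suc j) R) ∨ box π (suc j) (suc (length π)) R
      ≡⟨ cong (_∨ _) (box-merge π R z≤n (s≤s (<⇒≤ i<j)) ¬Ri) ⟩
    box π 0 (suc j) R ∨ box π (suc j) (suc (length π)) R
      ≡⟨ box-merge π R z≤n (s≤s (<⇒≤ j<n)) ¬Rj ⟩
    box π 0 (suc (length π)) R
      ≡⟨ box-last π 0 R ⟩
    any R π ∎

orderIso-12 : (a b : ℕ) → orderIso 2 (a ∷ b ∷ []) (1 ∷ 2 ∷ []) ≡ (a <ᵇ b)
orderIso-12 a b rewrite <ᵇ-false (≤-refl {a}) | <ᵇ-false (≤-refl {b}) with a <ᵇ b in a<b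
... | true  rewrite <ᵇ-false (<⇒≤ (<ᵇ⇒< a b (Equivalence.from T-≡ a<b))) = refl
... | false = refl

orderIso-21 : (a b : ℕ) → orderIso 2 (a ∷ b ∷ []) (2 ∷ 1 ∷ []) ≡ (b <ᵇ a)
orderIso-21 a b rewrite <ᵇ-false (≤-refl {a}) | <ᵇ-false (≤-refl {b}) with b <ᵇ a in b<a
... | true  rewrite <ᵇ-false (<⇒≤ (<ᵇ⇒< b a (Equivalence.from T-≡ b<a))) = refl
... | false = ∧-zeroʳ _

any-between-0 : {a : ℕ} (xs : List ℕ) → All (0 <_) xs → any (between 0 a) xs ≡ any (_<ᵇ a) xs
any-between-0 {a} xs positive =
  cong or (map-cong-local (All.map (λ {v} 0<v → cong (_∧ (v <ᵇ a)) (<ᵇ-true 0<v)) positive))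

any-between-top : {a top : ℕ} (xs : List ℕ) → All (_< top) xs → any (between a top) xs ≡ any (a <ᵇ_) xs
any-between-top {a} xs bounded =
  cong or (map-cong-local (All.map (λ {v} v<top → trans (cong ((a <ᵇ v) ∧_) (<ᵇ-true v<top)) (∧-identityʳ _))
                                    bounded))

-- Occurrences of p and p'

-- a and b are entries of π, a before b, and rest lists the entries after b
p-occurs : List ℕ → ℕ → ℕ → List ℕ → Bool
p-occurs π a b rest = (a <ᵇ b) ∧ (not (any (_<ᵇ a) π) ∧ not (any (between a b) rest))

p'-occurs : List ℕ → ℕ → ℕ → List ℕ → Bool
p'-occurs π a b rest = (b <ᵇ a) ∧ (not (any (between b a) π) ∧ not (any (a <ᵇ_) rest))

isOccurrence-p : (π : List ℕ) {i j : ℕ} → i < j → j < length π → All (0 <_) π →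
  isOccurrence p (length π) π (suc i ∷ suc j ∷ []) ≡ p-occurs π (nth π i) (nth π j) (drop (suc j) π)
isOccurrence-p π {i} {j} i<j j<n positive rewrite orderIso-12 (nth π i) (nth π j) with nth π i <ᵇ nth π j in a<ᵇb
... | false = refl
... | true rewrite ≤ᵇ-true (<⇒≤ (<ᵇ⇒< (nth π i) (nth π j) (Equivalence.from T-≡ a<ᵇb))) =
  trans (boxes-row-corner π (between 0 a) (between a b) i<j j<n
           (λ t → <-irrefl refl (<ᵇ⇒< a a (proj₂ (Equivalence.to T-∧ t))))
           (λ t → <⇒≱ a<b (<⇒≤ (<ᵇ⇒< b a (proj₂ (Equivalence.to T-∧ t))))))
        (cong (λ u → not u ∧ not (any (between a b) (drop (suc j) π))) (any-between-0 {a} π positive))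
  where
  a = nth π i
  b = nth π j
  a<b : a < b
  a<b = <ᵇ⇒< a b (Equivalence.from T-≡ a<ᵇb)

isOccurrence-p' : (π : List ℕ) {i j : ℕ} → i < j → j < length π → All (_< suc (length π)) π →
  isOccurrence p' (length π) π (suc i ∷ suc j ∷ []) ≡ p'-occurs π (nth π i) (nth π j) (drop (suc j) π)
isOccurrence-p' π {i} {j} i<j j<n bounded rewrite orderIso-21 (nth π i) (nth π j) with nth π j <ᵇ nth π i in b<ᵇa
... | false = refl
... | true rewrite ≤ᵇ-false (<ᵇ⇒< (nth π j) (nth π i) (Equivalence.from T-≡ b<ᵇa)) =
  trans (boxes-row-corner π (between b a) (between a (suc (length π))) i<j j<n
           (λ t → <-irrefl refl (<ᵇ⇒< a a (proj₂ (Equivalence.to T-∧ t))))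
           (λ t → <-irrefl refl (<ᵇ⇒< b b (proj₁ (Equivalence.to T-∧ t)))))
        (cong (λ u → not (any (between b a) π) ∧ not u)
              (any-between-top {a} (drop (suc j) π) (drop⁺ (suc j) bounded)))
  where
  a = nth π i
  b = nth π j

module _ where
  open Minima

  p-occurs⁻ : ∀ π a b rest → T (p-occurs π a b rest) →
              a < b × ¬ T (someBelow a π) × ¬ T (any (between a b) rest)
  p-occurs⁻ π a b rest t with a<ᵇb , t′ ← Equivalence.to T-∧ t with a-least , none ← Equivalence.to T-∧ t′ =
    <ᵇ⇒< a b a<ᵇb , T-not⇒¬T a-least , T-not⇒¬T none

  p-occurs-unique : ∀ {a a'} π b rest → a ∈ π → a' ∈ π →
                    T (p-occurs π a b rest) → T (p-occurs π a' b rest) → a ≡ a'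
  p-occurs-unique {a} {a'} π b rest a∈ a'∈ occ occ' =
    least-unique a∈ a'∈ (proj₁ (proj₂ (p-occurs⁻ π a b rest occ))) (proj₁ (proj₂ (p-occurs⁻ π a' b rest occ')))

  p-occurs⇒record : ∀ pre b rest → Unique (pre ++ b ∷ rest) →
    T (any (λ a → p-occurs (pre ++ b ∷ rest) a b rest) pre) →
    T (not (someBelow b rest) ∧ someBelow b (pre ++ b ∷ rest))
  p-occurs⇒record pre b rest !π t
    with a , a∈pre , occ ← find (any⁻ _ pre t)
    with a<b , a-least , none ← p-occurs⁻ (pre ++ b ∷ rest) a b rest occ =
    Equivalence.from T-∧ (¬T⇒T-not b-record , someBelow⁺ (∈-++⁺ˡ a∈pre) a<b)
    where
    b-record : ¬ T (someBelow b rest)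
    b-record t′ with z , z∈rest , z<b ← someBelow⁻ {b} rest t′ =
      none (any⁺ _ (lose z∈rest (between⁺ a<z z<b)))
      where
      a≢z = proj₂ (Unique-++⁻ pre !π) a∈pre (there z∈rest)
      a<z = ≤∧≢⇒< (≮⇒≥ (a-least ∘ someBelow⁺ (∈-++⁺ʳ pre (there z∈rest)))) a≢z

  record⇒p-occurs : ∀ pre b rest →
    T (not (someBelow b rest) ∧ someBelow b (pre ++ b ∷ rest)) →
    T (any (λ a → p-occurs (pre ++ b ∷ rest) a b rest) pre)
  record⇒p-occurs pre b rest t
    with b-record , b-notLeast ← Equivalence.to T-∧ t
    with z , z∈π , z<b ← someBelow⁻ {b} (pre ++ b ∷ rest) b-notLeast
    with m , m∈π , m-least ← least-exists z∈π =
    any⁺ _ (lose m∈pre (Equivalence.from T-∧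
      (<⇒<ᵇ m<b , Equivalence.from T-∧ (¬T⇒T-not m-least , ¬T⇒T-not none))))
    where
    m<b : m < b
    m<b = ≤-<-trans (≮⇒≥ (m-least ∘ someBelow⁺ z∈π)) z<b
    m∈pre : m ∈ pre
    m∈pre = ∈-prefix m∈π (λ m≡b → <-irrefl m≡b m<b) (λ m∈rest → T-not⇒¬T b-record (someBelow⁺ m∈rest m<b))
    none : ¬ T (any (between m b) rest)
    none t′ with w , w∈rest , m<w<b ← find (any⁻ _ rest t′) =
      T-not⇒¬T b-record (someBelow⁺ w∈rest (proj₂ (between⁻ m b w m<w<b)))

  -- a in an occurrence (a, b) of p must be the least entry, which lies before b exactly when
  -- b is a right-to-left minimum other than the least entry
  p-split : ∀ {π pre b rest} → pre ++ b ∷ rest ≡ π → Unique π →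
    countᵇ (λ a → p-occurs π a b rest) pre ≡ (if not (someBelow b rest) ∧ someBelow b π then 1 else 0)
  p-split {π} {pre} {b} {rest} refl !π =
    trans (countᵇ-atMostOne {P = λ a → p-occurs π a b rest} (proj₁ (Unique-++⁻ pre !π))
                            (λ a∈ a'∈ → p-occurs-unique π b rest (∈-++⁺ˡ a∈) (∈-++⁺ˡ a'∈)))
          (cong (λ c → if c then 1 else 0)
                (T-injective (mk⇔ (p-occurs⇒record pre b rest !π) (record⇒p-occurs pre b rest))))

module _ where
  open Maxima

  p'-occurs⁻ : ∀ π a b rest → T (p'-occurs π a b rest) →
               b < a × ¬ T (any (between b a) π) × ¬ T (someBelow a rest)
  p'-occurs⁻ π a b rest t with b<ᵇa , t′ ← Equivalence.to T-∧ t with none , a-record ← Equivalence.to T-∧ t′ =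
    <ᵇ⇒< b a b<ᵇa , T-not⇒¬T none , T-not⇒¬T a-record

  p'-occurs-unique : ∀ {a a'} π b rest → a ∈ π → a' ∈ π →
                     T (p'-occurs π a b rest) → T (p'-occurs π a' b rest) → a ≡ a'
  p'-occurs-unique {a} {a'} π b rest a∈ a'∈ occ occ'
    with b<a , none , _ ← p'-occurs⁻ π a b rest occ
    with b<a' , none' , _ ← p'-occurs⁻ π a' b rest occ'
    with <-cmp a a'
  ... | tri< a<a' _ _ = ⊥-elim (none' (any⁺ _ (lose a∈ (between⁺ b<a a<a'))))
  ... | tri≈ _ a≡a' _ = a≡a'
  ... | tri> _ _ a'<a = ⊥-elim (none (any⁺ _ (lose a'∈ (between⁺ b<a' a'<a))))

  p'-occurs⇒record : ∀ pre b rest → Unique (pre ++ b ∷ rest) →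
    T (any (λ a → p'-occurs (pre ++ b ∷ rest) a b rest) pre) →
    T (not (someBelow b rest) ∧ someBelow b (pre ++ b ∷ rest))
  p'-occurs⇒record pre b rest !π t
    with a , a∈pre , occ ← find (any⁻ _ pre t)
    with b<a , none , a-record ← p'-occurs⁻ (pre ++ b ∷ rest) a b rest occ =
    Equivalence.from T-∧ (¬T⇒T-not b-record , someBelow⁺ (∈-++⁺ˡ a∈pre) b<a)
    where
    b-record : ¬ T (someBelow b rest)
    b-record t′ with z , z∈rest , b<z ← someBelow⁻ {b} rest t′ with <-cmp z a
    ... | tri< z<a _ _ = none (any⁺ _ (lose (∈-++⁺ʳ pre (there z∈rest)) (between⁺ b<z z<a)))
    ... | tri≈ _ z≡a _ = proj₂ (Unique-++⁻ pre !π) a∈pre (there z∈rest) (sym z≡a)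
    ... | tri> _ _ a<z = a-record (someBelow⁺ z∈rest a<z)

  record⇒p'-occurs : ∀ pre b rest →
    T (not (someBelow b rest) ∧ someBelow b (pre ++ b ∷ rest)) →
    T (any (λ a → p'-occurs (pre ++ b ∷ rest) a b rest) pre)
  record⇒p'-occurs pre b rest t
    with b-record , b-notGreatest ← Equivalence.to T-∧ t
    with z , z∈π , b<z ← someBelow⁻ {b} (pre ++ b ∷ rest) b-notGreatest
    with s , s∈above , s-least ← Minima.least-exists (∈-filter⁺ (b <?_) z∈π b<z)
    with s∈π , b<s ← ∈-filter⁻ (b <?_) s∈above =
    any⁺ _ (lose s∈pre (Equivalence.from T-∧
      (<⇒<ᵇ b<s , Equivalence.from T-∧ (¬T⇒T-not none , ¬T⇒T-not s-record))))
    where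
    s∈pre : s ∈ pre
    s∈pre = ∈-prefix s∈π (λ s≡b → <-irrefl (sym s≡b) b<s) (λ s∈rest → T-not⇒¬T b-record (someBelow⁺ s∈rest b<s))
    none : ¬ T (any (between b s) (pre ++ b ∷ rest))
    none t′ with w , w∈π , b<w<s ← find (any⁻ _ (pre ++ b ∷ rest) t′)
            with b<w , w<s ← between⁻ b s w b<w<s =
      s-least (Minima.someBelow⁺ (∈-filter⁺ (b <?_) w∈π b<w) w<s)
    s-record : ¬ T (someBelow s rest)
    s-record t′ with w , w∈rest , s<w ← someBelow⁻ {s} rest t′ =
      T-not⇒¬T b-record (someBelow⁺ w∈rest (<-trans b<s s<w))

  -- a in an occurrence (a, b) of p' must be the successor of b among the entries, which lies
  -- before b exactly when b is a right-to-left maximum other than the greatest entry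
  p'-split : ∀ {π pre b rest} → pre ++ b ∷ rest ≡ π → Unique π →
    countᵇ (λ a → p'-occurs π a b rest) pre ≡ (if not (someBelow b rest) ∧ someBelow b π then 1 else 0)
  p'-split {π} {pre} {b} {rest} refl !π =
    trans (countᵇ-atMostOne {P = λ a → p'-occurs π a b rest} (proj₁ (Unique-++⁻ pre !π))
                            (λ a∈ a'∈ → p'-occurs-unique π b rest (∈-++⁺ˡ a∈) (∈-++⁺ˡ a'∈)))
          (cong (λ c → if c then 1 else 0)
                (T-injective (mk⇔ (p'-occurs⇒record pre b rest !π) (record⇒p'-occurs pre b rest))))

-- Permutations

count-byRecords : (pat : MeshPattern) (records : List ℕ → ℕ) (n k : ℕ) →
  (∀ {π} → π ∈ words n n → T (distinct π) → suc (occ pat n π) ≡ records π) →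
  count pat n k ≡ countᵇ (λ w → distinct w ∧ (records w ≡ᵇ suc k)) (wordsOver n (range1 n))
count-byRecords pat records n k suc-occ≡records = begin
  countᵇ (λ π → occ pat n π ≡ᵇ k) (filterᵇ distinct (words n n))
    ≡⟨ countᵇ-filterᵇ (λ π → occ pat n π ≡ᵇ k) distinct (words n n) ⟩
  countᵇ (λ w → distinct w ∧ (occ pat n w ≡ᵇ k)) (words n n)
    ≡⟨ countᵇ-cong-∧ (words n n) (λ w∈ dw → cong (_≡ᵇ suc k) (suc-occ≡records w∈ dw)) ⟩
  countᵇ (λ w → distinct w ∧ (records w ≡ᵇ suc k)) (words n n)
    ≡⟨ cong (countᵇ _) (words≡wordsOver n n) ⟩
  countᵇ (λ w → distinct w ∧ (records w ≡ᵇ suc k)) (wordsOver n (range1 n)) ∎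

Unique-range1 : (n : ℕ) → Unique (range1 n)
Unique-range1 n = applyUpTo⁺₁ suc n (λ i<j _ → <⇒≢ i<j ∘ suc-injective)

∈-range1⁻ : ∀ {n v} → v ∈ range1 n → 0 < v × v < suc n
∈-range1⁻ v∈ with i , i<n , refl ← ∈-applyUpTo⁻ suc v∈ = s≤s z≤n , s≤s i<n

permutation⁻ : ∀ {n π} → π ∈ words n n → T (distinct π) →
               length π ≡ n × Unique π × All (0 <_) π × All (_< suc n) π
permutation⁻ {n} {π} π∈ dπ with |π|≡n , π⊆ ← ∈-wordsOver⁻ n (subst (π ∈_) (words≡wordsOver n n) π∈) =
  |π|≡n , distinct⇒Unique π dπ , All.unzip (All.map ∈-range1⁻ π⊆)

occ-p-records : ∀ {n π} → 1 ≤ n → π ∈ words n n → T (distinct π) → suc (occ p n π) ≡ Minima.records π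
occ-p-records {n} {[]}     1≤n π∈ dπ with refl ← proj₁ (permutation⁻ {n} π∈ dπ) with () ← 1≤n
occ-p-records {n} {x ∷ xs} _   π∈ dπ with refl , !π , positive , _ ← permutation⁻ {n} π∈ dπ =
  trans (cong suc (occ-pairCount {τ p} {shaded p} (p-occurs π) π
                     λ i<j j<n → isOccurrence-p π i<j j<n positive))
        (Minima.pairCount-records (p-occurs π) π !π (here refl) (λ split → p-split split !π))
  where
  π = x ∷ xs

occ-p'-records : ∀ {n π} → 1 ≤ n → π ∈ words n n → T (distinct π) → suc (occ p' n π) ≡ Maxima.records π
occ-p'-records {n} {[]}     1≤n π∈ dπ with refl ← proj₁ (permutation⁻ {n} π∈ dπ) with () ← 1≤n
occ-p'-records {n} {x ∷ xs} _   π∈ dπ with refl , !π , _ , bounded ← permutation⁻ {n} π∈ dπ =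
  trans (cong suc (occ-pairCount {τ p'} {shaded p'} (p'-occurs π) π
                     λ i<j j<n → isOccurrence-p' π i<j j<n bounded))
        (Maxima.pairCount-records (p'-occurs π) π !π (here refl) (λ split → p'-split split !π))
  where
  π = x ∷ xs

count-p : ∀ n k → 1 ≤ n → count p n k ≡ c n (suc k)
count-p n k 1≤n = trans (count-byRecords p Minima.records n k (occ-p-records 1≤n))
                        (Minima.records-distribution n (Unique-range1 n) (length-applyUpTo suc n) (suc k))

count-p' : ∀ n k → 1 ≤ n → count p' n k ≡ c n (suc k)
count-p' n k 1≤n = trans (count-byRecords p' Maxima.records n k (occ-p'-records 1≤n))
                         (Maxima.records-distribution n (Unique-range1 n) (length-applyUpTo suc n) (suc k))

lemma3p2 : Equidistributed p p'
    × (∀ (n k : ℕ) → 1 ≤ n → count p n k ≡ c n (suc k))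
lemma3p2 = equidistributed , count-p
  where
  equidistributed : Equidistributed p p'
  -- S 0 consists of the empty permutation, which has no occurrences of either pattern
  equidistributed zero    k = refl
  equidistributed (suc n) k = trans (count-p (suc n) k (s≤s z≤n)) (sym (count-p' (suc n) k (s≤s z≤n)))
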